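{- Let $p,q$ be odd primes and $e$ a positive integer. If $\sigma^{**}(p^e)=2^a q^b$ for some integers $a$ and $b$, then one of the following holds: (a) $e=1$; (b) $e=2$ and $p^2+1=2q^b$; (c) $e=3$, $p=2^{a-1}-1$ is a Mersenne prime, and $p^2+1=2q^b$; (d) $e=4$, $p=2^{a/2}-1$ is a Mersenne prime, and $p^2-p+1=q^b$. Moreover, if $e$ is a positive integer such that $\sigma^{**}(2^e)$ is a prime power, then $e\leq 4$.
   Context: $\sigma^{**}(n)$ is the sum of the biunitary divisors of $n$, where a divisor $d$ of $n$ is biunitary if the greatest common unitary divisor of $d$ and $n/d$ is $1$ (a divisor $u$ of $m$ is unitary if $\gcd(u,m/u)=1$). For a prime $p$ and positive integer $e$: $\sigma^{**}(p^e)=\frac{p^{e+1}-1}{p-1}$ if $e$ is odd, and $\sigma^{**}(p^e)=\frac{p^{e+1}-1}{p-1}-p^{e/2}$ if $e$ is even. A Mersenne prime is a prime of the form $2^k-1$. -}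

module Defs where

open import Data.Nat using (ℕ; zero; suc; _+_; _*_; _∸_; _^_)
open import Data.Nat.DivMod using (_/_; _%_)

geomSum : ℕ → ℕ → ℕ
geomSum p zero    = 1
geomSum p (suc e) = geomSum p e + p ^ suc e

-- σ**(p^e), the sum of biunitary divisors of a prime power p^e (p prime, e ≥ 1):
--   (p^(e+1)-1)/(p-1)            if e is odd
--   (p^(e+1)-1)/(p-1) - p^(e/2)  if e is even
σ**pp : ℕ → ℕ → ℕ
σ**pp p e with e % 2
... | zero  = geomSum p e ∸ p ^ (e / 2)
... | suc _ = geomSum p e

module Submission where

-- Write S r n = 1 + r + … + r^(n-1).  The biunitary sum of a prime power
-- factors as  σ**(p^(2k-1)) = S p k·(1 + p^k)  and
-- σ**(p^(2m)) = S p m·(1 + p^(m+1)).  The identities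
-- (b - 1)·S b n + 2 = 1 + b^n  and  1 + b^(m+1) = b(b - 1)·S b m + (1 + b)
-- show that a common divisor of the two factors divides 2, and even 1
-- when m is odd (common-S-1+pow, common-S-1+pow-odd).
--
-- For odd p ≥ 3 the numbers 1 + p^n (n ≥ 2) and
-- S p n (n ≥ 3) have an odd divisor > 1 (OddFactor), and every such
-- divisor of 2^a·q^b is a multiple of q.  So for e ≥ 5, q divides both
-- factors above, which is impossible.  For e ≤ 4 the factorisations
-- σ** = 1 + p², (1 + p)(1 + p²), (1 + p)²·Φ₆(p) are settled by 2-adic
-- bookkeeping: 1 + p is prime to q, hence a power of two, and the odd
-- parts (1 + p²)/2 resp. Φ₆(p) = p² - p + 1 equal q^b.
--
-- Part 2 (p = 2, σ**(2^e) = r^m).  Every divisor > 1 of r^m is a multiple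
-- of r, so the same common-divisor identities exclude all e ≥ 5.

open import Defs
open import Data.Nat using (ℕ; zero; suc; _+_; _*_; _∸_; _^_; _≤_; _≥_)
open import Data.Nat.Primality using (Prime)
open import Data.Product using (_×_; ∃-syntax)
open import Data.Sum using (_⊎_)
open import Relation.Binary.PropositionalEquality using (_≡_; _≢_)

open import Data.Nat using (s≤s; z≤n)
open import Data.Nat.Properties
open import Data.Nat.Divisibility
open import Data.Nat.DivMod using (_/_; _%_; m*n/n≡m; m*n%n≡0; [m+kn]%n≡m%n)
open import Data.Nat.Primality using (prime[2]; ¬prime[1]; prime?; euclidsLemma; prime⇒irreducible)
open import Data.Nat.Primality.Factorisation using (factorise)
open import Data.Nat.ListAction using (product)
open import Data.Nat.Tactic.RingSolver using (solve-∀)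
open import Data.List using ([]; _∷_)
open import Data.List.Relation.Unary.All using (_∷_)
open import Data.Product using (_,_; proj₁; proj₂)
open import Data.Sum using (inj₁; inj₂)
open import Data.Empty using (⊥-elim)
open import Relation.Nullary using (¬_; yes; no)
open import Relation.Nullary.Decidable using (from-yes)
open import Relation.Binary.PropositionalEquality
  using (refl; sym; trans; cong; cong₂; subst; subst₂; module ≡-Reasoning)

open ≡-Reasoning

-- Odd numbers, given by an explicit witness so that ring identities apply.
Odd : ℕ → Set
Odd n = ∃[ k ] n ≡ suc (k + k)

data Parity : ℕ → Set where
  even : ∀ k → Parity (k + k)
  odd  : ∀ k → Parity (suc (k + k))

parity : ∀ n → Parity n
parity zero = even 0
parity (suc n) with parity n
... | even k = odd k
... | odd k  = subst Parity (cong suc (+-suc k k)) (even (suc k))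

double≡*2 : ∀ m → m + m ≡ m * 2
double≡*2 = solve-∀

2∣double : ∀ k → 2 ∣ k + k
2∣double k = divides k (double≡*2 k)

prime∤1 : ∀ {q} → Prime q → ¬ q ∣ 1
prime∤1 pq q∣1 = ¬prime[1] (subst Prime (∣1⇒≡1 q∣1) pq)

odd⇒2∤ : ∀ {n} → Odd n → ¬ 2 ∣ n
odd⇒2∤ (k , refl) 2∣n =
  prime∤1 prime[2] (∣m+n∣m⇒∣n (subst (2 ∣_) (+-comm 1 (k + k)) 2∣n) (2∣double k))

odd-* : ∀ {m n} → Odd m → Odd n → Odd (m * n)
odd-* (x , refl) (y , refl) = x + y + (x + x) * y , product≡ x y
  where
  product≡ : ∀ x y → suc (x + x) * suc (y + y) ≡ suc (x + y + (x + x) * y + (x + y + (x + x) * y))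
  product≡ = solve-∀

odd-^ : ∀ {r} → Odd r → ∀ n → Odd (r ^ n)
odd-^ r-odd zero    = 0 , refl
odd-^ r-odd (suc n) = odd-* r-odd (odd-^ r-odd n)

S : ℕ → ℕ → ℕ
S r zero    = 0
S r (suc n) = 1 + r * S r n

S-snoc : ∀ r n → S r (suc n) ≡ S r n + r ^ n
S-snoc r zero    = cong suc (*-zeroʳ r)
S-snoc r (suc n) = trans (cong (λ x → 1 + r * x) (S-snoc r n)) (distrib r (S r n) (r ^ n))
  where
  distrib : ∀ r x y → 1 + r * (x + y) ≡ (1 + r * x) + r * y
  distrib = solve-∀

geomSum≡S : ∀ p e → geomSum p e ≡ S p (suc e)
geomSum≡S p zero    = cong suc (sym (*-zeroʳ p))
geomSum≡S p (suc e) = trans (cong (_+ p ^ suc e) (geomSum≡S p e)) (sym (S-snoc p (suc e)))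

S-+ : ∀ r m n → S r (m + n) ≡ S r m + r ^ m * S r n
S-+ r zero    n = sym (+-identityʳ (S r n))
S-+ r (suc m) n = trans (cong (λ x → 1 + r * x) (S-+ r m n)) (distrib r (S r m) (r ^ m) (S r n))
  where
  distrib : ∀ r x y z → 1 + r * (x + y * z) ≡ (1 + r * x) + r * y * z
  distrib = solve-∀

S-double : ∀ r m → S r (m + m) ≡ S r m * (1 + r ^ m)
S-double r m = trans (S-+ r m m) (factor (S r m) (r ^ m))
  where
  factor : ∀ x y → x + y * x ≡ x * (1 + y)
  factor = solve-∀

S-evenLength : ∀ r j → S r (j + j) ≡ (1 + r) * S (r * r) j
S-evenLength r zero    = sym (*-zeroʳ (1 + r))
S-evenLength r (suc j) =
  trans (cong (λ n → S r (suc n)) (+-suc j j))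
        (trans (cong (λ x → 1 + r * (1 + r * x)) (S-evenLength r j)) (regroup r (S (r * r) j)))
  where
  regroup : ∀ r c → 1 + r * (1 + r * ((1 + r) * c)) ≡ (1 + r) * (1 + r * r * c)
  regroup = solve-∀

S-geometric : ∀ t n → S (suc t) n * t + 1 ≡ suc t ^ n
S-geometric t zero    = refl
S-geometric t (suc n) = trans (shift t (S (suc t) n)) (cong (suc t *_) (S-geometric t n))
  where
  shift : ∀ t x → (1 + (1 + t) * x) * t + 1 ≡ (1 + t) * (x * t + 1)
  shift = solve-∀

S-two : ∀ r → S r 2 ≡ 1 + r
S-two r = trans (cong (λ x → 1 + r * suc x) (*-zeroʳ r)) (cong suc (*-identityʳ r))

n≤S : ∀ t n → n ≤ S (suc t) n
n≤S t zero    = z≤n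
n≤S t (suc n) = s≤s (≤-trans (n≤S t n) (m≤m+n _ _))

S-odd : ∀ {r} → Odd r → ∀ j → Odd (S r (suc (j + j)))
S-odd {r} (k , refl) j =
  r * suc k * S (r * r) j ,
  trans (cong (λ x → 1 + r * x) (S-evenLength r j)) (oddForm r k (S (r * r) j))
  where
  oddForm : ∀ r k c → 1 + r * ((1 + suc (k + k)) * c) ≡ suc (r * suc k * c + r * suc k * c)
  oddForm = solve-∀

σ**-odd : ∀ p k → σ**pp p (suc (k + k)) ≡ S p (suc k) * (1 + p ^ suc k)
σ**-odd p k with suc (k + k) % 2 | trans (cong (λ n → suc n % 2) (double≡*2 k)) ([m+kn]%n≡m%n 1 k 2)
... | _ | refl = begin
  geomSum p (suc (k + k))   ≡⟨ geomSum≡S p (suc (k + k)) ⟩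
  S p (suc (suc (k + k)))   ≡⟨ cong (λ n → S p (suc n)) (sym (+-suc k k)) ⟩
  S p (suc k + suc k)       ≡⟨ S-double p (suc k) ⟩
  S p (suc k) * (1 + p ^ suc k) ∎

σ**-even : ∀ p m → σ**pp p (m + m) ≡ S p m * (1 + p ^ suc m)
σ**-even p m with (m + m) % 2 | trans (cong (_% 2) (double≡*2 m)) (m*n%n≡0 m 2)
... | _ | refl = begin
  geomSum p (m + m) ∸ p ^ ((m + m) / 2)   ≡⟨ cong₂ _∸_ (geomSum≡S p (m + m)) (cong (p ^_) half) ⟩
  S p (suc (m + m)) ∸ p ^ m                ≡⟨ cong (λ x → x ∸ p ^ m) expand ⟩
  S p m * (1 + p ^ suc m) + p ^ m ∸ p ^ m  ≡⟨ m+n∸n≡m _ (p ^ m) ⟩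
  S p m * (1 + p ^ suc m)                  ∎
  where
  half : (m + m) / 2 ≡ m
  half = trans (cong (_/ 2) (double≡*2 m)) (m*n/n≡m m 2)
  regroup : ∀ x y p → x + y * (1 + p * x) ≡ x * (1 + p * y) + y
  regroup = solve-∀
  expand : S p (suc (m + m)) ≡ S p m * (1 + p ^ suc m) + p ^ m
  expand = trans (cong (S p) (sym (+-suc m m)))
                 (trans (S-+ p m (suc m)) (regroup (S p m) (p ^ m) p))

-- Since (b - 1)·S b n + 2 = 1 + b^n, a common divisor of S b n and
-- 1 + b^n divides 2 (here b = suc t).
common-S-1+pow : ∀ {d} t n → d ∣ S (suc t) n → d ∣ 1 + suc t ^ n → d ∣ 2
common-S-1+pow {d} t n d∣S d∣pow = ∣m+n∣m⇒∣n (subst (d ∣_) split d∣pow) (∣m⇒∣m*n t d∣S)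
  where
  split : 1 + suc t ^ n ≡ S (suc t) n * t + 2
  split = trans (cong suc (sym (S-geometric t n))) (sym (+-suc _ 1))

-- For odd m = 2j+1: 1 + b^(m+1) = b(b-1)·S b m + (1 + b) and
-- S b m = 1 + b(1 + b)·S (b²) j, so a common divisor of S b m and
-- 1 + b^(m+1) divides 1 + b and hence 1.
common-S-1+pow-odd : ∀ {d} t j → d ∣ S (suc t) (suc (j + j)) →
                     d ∣ 1 + suc t ^ suc (suc (j + j)) → d ∣ 1
common-S-1+pow-odd {d} t j d∣S d∣pow =
  ∣m+n∣m⇒∣n (subst (d ∣_) S-form d∣S) (∣n⇒∣m*n (b * C) d∣1+b)
  where
  b m C : ℕ
  b = suc t
  m = suc (j + j)
  C = S (b * b) j
  pow-regroup : ∀ b t x → 1 + b * (x * t + 1) ≡ b * t * x + (1 + b)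
  pow-regroup = solve-∀
  pow-form : 1 + b ^ suc m ≡ b * t * S b m + (1 + b)
  pow-form = trans (cong (λ x → 1 + b * x) (sym (S-geometric t m))) (pow-regroup b t (S b m))
  d∣1+b : d ∣ 1 + b
  d∣1+b = ∣m+n∣m⇒∣n (subst (d ∣_) pow-form d∣pow) (∣n⇒∣m*n (b * t) d∣S)
  S-regroup : ∀ b c → 1 + b * ((1 + b) * c) ≡ b * c * (1 + b) + 1
  S-regroup = solve-∀
  S-form : S b m ≡ b * C * (1 + b) + 1
  S-form = trans (cong (λ x → 1 + b * x) (S-evenLength b j)) (S-regroup b C)

prime∣prime : ∀ {s q} → Prime s → Prime q → s ∣ q → s ≡ q
prime∣prime ps pq s∣q with prime⇒irreducible pq s∣q
... | inj₁ refl = ⊥-elim (¬prime[1] ps)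
... | inj₂ s≡q  = s≡q

prime∣^ : ∀ {s} r n → Prime s → s ∣ r ^ n → s ∣ r
prime∣^ r zero    ps s∣1 = ⊥-elim (prime∤1 ps s∣1)
prime∣^ r (suc n) ps s∣r^n+1 with euclidsLemma r (r ^ n) ps s∣r^n+1
... | inj₁ s∣r   = s∣r
... | inj₂ s∣r^n = prime∣^ r n ps s∣r^n

primeFactor : ∀ X → 2 ≤ X → ∃[ s ] (Prime s × s ∣ X)
primeFactor (suc zero) (s≤s ())
primeFactor (suc (suc x)) _ with factorise (suc (suc x))
... | record { factors = [] ; isFactorisation = () }
... | record { factors = s ∷ ss ; isFactorisation = X≡ ; factorsPrime = ps ∷ _ } =
  s , ps , subst (s ∣_) (sym X≡) (m∣m*n (product ss))

-- An odd divisor > 1 of 2^a·q^b is a multiple of q: its prime factors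
-- divide 2 or q.
oddDivisor⇒q∣ : ∀ {q X} a b → Prime q → X ∣ 2 ^ a * q ^ b → ¬ 2 ∣ X → 2 ≤ X → q ∣ X
oddDivisor⇒q∣ {q} {X} a b pq X∣N 2∤X 2≤X with primeFactor X 2≤X
... | s , ps , s∣X with euclidsLemma (2 ^ a) (q ^ b) ps (∣-trans s∣X X∣N)
...   | inj₁ s∣2^a = ⊥-elim (2∤X (subst (_∣ X) (prime∣prime ps prime[2] (prime∣^ 2 a ps s∣2^a)) s∣X))
...   | inj₂ s∣q^b = subst (_∣ X) (prime∣prime ps pq (prime∣^ q b ps s∣q^b)) s∣X

primePowerDivisor : ∀ {r X} m → Prime r → X ∣ r ^ m → 2 ≤ X → r ∣ X
primePowerDivisor {r} {X} m pr X∣r^m 2≤X with primeFactor X 2≤X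
... | s , ps , s∣X = subst (_∣ X) (prime∣prime ps pr (prime∣^ r m ps (∣-trans s∣X X∣r^m))) s∣X

2-adic-unique : ∀ x y {M N} → 2 ^ x * M ≡ 2 ^ y * N → ¬ 2 ∣ M → ¬ 2 ∣ N → x ≡ y × M ≡ N
2-adic-unique zero    zero    {M} {N} eq _ _ = refl , trans (sym (*-identityˡ M)) (trans eq (*-identityˡ N))
2-adic-unique zero    (suc y) {M} {N} eq 2∤M _ =
  ⊥-elim (2∤M (subst (2 ∣_) (trans (sym eq) (*-identityˡ M)) (∣m⇒∣m*n N (m∣m*n (2 ^ y)))))
2-adic-unique (suc x) zero    {M} {N} eq _ 2∤N =
  ⊥-elim (2∤N (subst (2 ∣_) (trans eq (*-identityˡ N)) (∣m⇒∣m*n M (m∣m*n (2 ^ x)))))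
2-adic-unique (suc x) (suc y) {M} {N} eq 2∤M 2∤N
  with 2-adic-unique x y
         (*-cancelˡ-≡ _ _ 2 (trans (sym (*-assoc 2 (2 ^ x) M)) (trans eq (*-assoc 2 (2 ^ y) N))))
         2∤M 2∤N
... | refl , M≡N = refl , M≡N

oddPart≡1 : ∀ {q} a b X → Prime q → X ∣ 2 ^ a * q ^ b → ¬ 2 ∣ X → ¬ q ∣ X → X ≡ 1
oddPart≡1 a b zero          pq X∣N 2∤X q∤X = ⊥-elim (2∤X (divides 0 refl))
oddPart≡1 a b (suc zero)    pq X∣N 2∤X q∤X = refl
oddPart≡1 a b (suc (suc x)) pq X∣N 2∤X q∤X =
  ⊥-elim (q∤X (oddDivisor⇒q∣ a b pq X∣N 2∤X (s≤s (s≤s z≤n))))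

-- A divisor of 2^a·q^b that is prime to q is a power of two: halve it
-- while it is even.
powerOfTwo : ∀ {q} a b X → Prime q → X ∣ 2 ^ a * q ^ b → ¬ q ∣ X → ∃[ k ] X ≡ 2 ^ k
powerOfTwo a b X pq X∣N q∤X with 2 ∣? X
... | no 2∤X = 0 , oddPart≡1 a b X pq X∣N 2∤X q∤X
powerOfTwo {q} zero b X pq X∣N q∤X | yes 2∣X = ⊥-elim (q∤X (subst (_∣ X) 2≡q 2∣X))
  where
  2≡q : 2 ≡ q
  2≡q = prime∣prime prime[2] pq
          (prime∣^ q b prime[2] (∣-trans 2∣X (subst (X ∣_) (*-identityˡ (q ^ b)) X∣N)))
powerOfTwo {q} (suc a) b X pq X∣N q∤X | yes (divides c X≡c*2) =
  suc k , trans X≡c*2 (trans (cong (_* 2) c≡2^k) (*-comm (2 ^ k) 2))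
  where
  shift : ∀ x y → 2 * x * y ≡ x * y * 2
  shift = solve-∀
  c∣N : c ∣ 2 ^ a * q ^ b
  c∣N = *-cancelʳ-∣ 2 (subst₂ _∣_ X≡c*2 (shift (2 ^ a) (q ^ b)) X∣N)
  c-power : ∃[ k ] c ≡ 2 ^ k
  c-power = powerOfTwo a b c pq c∣N (λ q∣c → q∤X (subst (q ∣_) (sym X≡c*2) (∣m⇒∣m*n 2 q∣c)))
  k : ℕ
  k = proj₁ c-power
  c≡2^k : c ≡ 2 ^ k
  c≡2^k = proj₂ c-power

-- X is not a power of two: it has an odd divisor greater than 1.
OddFactor : ℕ → Set
OddFactor X = ∃[ Y ] (Y ∣ X × ¬ 2 ∣ Y × 2 ≤ Y)

oddFactor-self : ∀ {X} → Odd X → 2 ≤ X → OddFactor X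
oddFactor-self X-odd 2≤X = _ , ∣-refl , odd⇒2∤ X-odd , 2≤X

oddFactor-∣ : ∀ {X Z} → X ∣ Z → OddFactor X → OddFactor Z
oddFactor-∣ X∣Z (Y , Y∣X , 2∤Y , 2≤Y) = Y , ∣-trans Y∣X X∣Z , 2∤Y , 2≤Y

oddFactor⇒q∣ : ∀ {q X} a b → Prime q → X ∣ 2 ^ a * q ^ b → OddFactor X → q ∣ X
oddFactor⇒q∣ a b pq X∣N (Y , Y∣X , 2∤Y , 2≤Y) =
  ∣-trans (oddDivisor⇒q∣ a b pq (∣-trans Y∣X X∣N) 2∤Y 2≤Y) Y∣X

1+square : ∀ k → 1 + suc (k + k) ^ 2 ≡ 2 * suc (k + k * k + (k + k * k))
1+square = expanded
  where
  expanded : ∀ k → 1 + suc (k + k) * (suc (k + k) * 1) ≡ 2 * suc (k + k * k + (k + k * k))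
  expanded = solve-∀

halfOf1+square : ∀ {x} → Odd x → ∃[ M ] (1 + x ^ 2 ≡ 2 * M × ¬ 2 ∣ M)
halfOf1+square (k , refl) = _ , 1+square k , odd⇒2∤ (k + k * k , refl)

oddFactor-1+square : ∀ {x} → Odd x → 3 ≤ x → OddFactor (1 + x ^ 2)
oddFactor-1+square (zero  , refl) (s≤s ())
oddFactor-1+square (suc k , refl) _ =
  M , divides 2 (1+square (suc k)) , odd⇒2∤ (w , refl) , s≤s (s≤s z≤n)
  where
  w M : ℕ
  w = suc k + suc k * suc k
  M = suc (w + w)

pow-square : ∀ r i → r ^ (i + i) ≡ (r ^ i) ^ 2
pow-square r i = trans (^-distribˡ-+-* r i i) (cong (r ^ i *_) (sym (*-identityʳ (r ^ i))))

pow-double : ∀ b j → b ^ (j + j) ≡ (b * b) ^ j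
pow-double b zero    = refl
pow-double b (suc j) =
  trans (cong (λ n → b * b ^ n) (+-suc j j))
        (trans (sym (*-assoc b b (b ^ (j + j)))) (cong (b * b *_) (pow-double b j)))

3≤pow : ∀ {r} → 3 ≤ r → ∀ i → 3 ≤ r ^ suc i
3≤pow {suc r} 3≤r i =
  ≤-trans 3≤r (subst (_≤ suc r ^ suc i) (*-identityʳ (suc r)) (^-monoʳ-≤ (suc r) {1} {suc i} (s≤s z≤n)))

-- The cofactor (1 + b^(2j+1)) / (1 + b) for the base b = suc t.
cofactor : ℕ → ℕ → ℕ
cofactor t j = 1 + t * suc t * S (suc t * suc t) j

1+pow-oddExp : ∀ t j → 1 + suc t ^ suc (j + j) ≡ (2 + t) * cofactor t j
1+pow-oddExp t j = begin
  1 + b * b ^ (j + j)                         ≡⟨ cong (λ x → 1 + b * x) (pow-double b j) ⟩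
  1 + b * (b * b) ^ j                         ≡⟨ cong (λ x → 1 + b * x) (sym (S-geometric (t + t * b) j)) ⟩
  1 + b * (S (b * b) j * (t + t * b) + 1)     ≡⟨ regroup t (S (b * b) j) ⟩
  (2 + t) * cofactor t j                      ∎
  where
  b : ℕ
  b = suc t
  regroup : ∀ t c → 1 + (1 + t) * (c * (t + t * (1 + t)) + 1) ≡ (2 + t) * (1 + t * (1 + t) * c)
  regroup = solve-∀

oddFactor-cofactor : ∀ h {j} → 1 ≤ j → OddFactor (cofactor (suc h + suc h) j)
oddFactor-cofactor h {suc j} _ =
  oddFactor-self (suc h * b * S (b * b) (suc j) , oddForm (suc h) b (S (b * b) (suc j))) (s≤s (s≤s z≤n))
  where
  b : ℕ
  b = suc (suc h + suc h)
  oddForm : ∀ u b c → 1 + (u + u) * b * c ≡ suc (u * b * c + u * b * c)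
  oddForm = solve-∀

oddFactor-1+pow : ∀ {r} n → Odd r → 3 ≤ r → 2 ≤ n → OddFactor (1 + r ^ n)
oddFactor-1+pow n r-odd 3≤r 2≤n with parity n
oddFactor-1+pow .(zero + zero) r-odd 3≤r () | even zero
oddFactor-1+pow {r} .(suc i + suc i) r-odd 3≤r _ | even (suc i) =
  subst (λ x → OddFactor (1 + x)) (sym (pow-square r (suc i)))
        (oddFactor-1+square (odd-^ r-odd (suc i)) (3≤pow 3≤r i))
oddFactor-1+pow .(suc (zero + zero)) r-odd 3≤r (s≤s ()) | odd zero
oddFactor-1+pow .(suc (suc j + suc j)) (zero , refl) (s≤s ()) _ | odd (suc j)
oddFactor-1+pow .(suc (suc j + suc j)) (suc h , refl) _ _ | odd (suc j) =
  oddFactor-∣ (divides (2 + t) (1+pow-oddExp t (suc j))) (oddFactor-cofactor h {suc j} (s≤s z≤n))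
  where
  t : ℕ
  t = suc h + suc h

half≥2 : ∀ j → 3 ≤ j + j → 2 ≤ j
half≥2 zero          ()
half≥2 (suc zero)    (s≤s (s≤s ()))
half≥2 (suc (suc j)) _ = s≤s (s≤s z≤n)

-- For odd r ≥ 3 and n ≥ 3, S r n is not a power of two: for odd n it is
-- itself odd, for even n = 2j it is divisible by 1 + r^j.
oddFactor-S : ∀ {r} n → Odd r → 3 ≤ r → 3 ≤ n → OddFactor (S r n)
oddFactor-S n r-odd 3≤r 3≤n with parity n
oddFactor-S {r} .(suc (j + j)) r-odd@(k , refl) 3≤r 3≤n | odd j =
  oddFactor-self (S-odd r-odd j) (≤-trans (<⇒≤ 3≤n) (n≤S (k + k) (suc (j + j))))
oddFactor-S {r} .(j + j) r-odd 3≤r 3≤n | even j =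
  oddFactor-∣ (divides (S r j) (S-double r j)) (oddFactor-1+pow j r-odd 3≤r (half≥2 j 3≤n))

oddFactor-S-square : ∀ {x} n → Odd x → 3 ≤ x → 2 ≤ n → OddFactor (S (x * x) n)
oddFactor-S-square n x-odd 3≤x 2≤n with parity n
oddFactor-S-square {x} .(suc (j + j)) x-odd@(k , refl) 3≤x 2≤n | odd j =
  oddFactor-self (S-odd (odd-* x-odd x-odd) j) (≤-trans 2≤n (n≤S _ (suc (j + j))))
oddFactor-S-square {x} .(j + j) x-odd 3≤x 2≤n | even j =
  oddFactor-∣ (divides (S (x * x) j) (S-double (x * x) j))
              (subst (λ y → OddFactor (1 + y)) (pow-double x j) (oddFactor-1+pow (j + j) x-odd 3≤x 2≤n))

oddPrime : ∀ {p} → Prime p → p ≢ 2 → Odd p × 3 ≤ p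
oddPrime {p} pp p≢2 with parity p
... | even k       = ⊥-elim (p≢2 (sym (prime∣prime prime[2] pp (2∣double k))))
... | odd zero     = ⊥-elim (¬prime[1] pp)
... | odd (suc k)  = (suc k , refl) , s≤s (s≤s (≤-trans (s≤s z≤n) (m≤n+m (suc k) k)))

prime[3] : Prime 3
prime[3] = from-yes (prime? 3)

σ**-square : ∀ p → σ**pp p 2 ≡ 1 + p ^ 2
σ**-square p =
  trans (σ**-even p 1) (trans (cong (λ x → suc x * (1 + p ^ 2)) (*-zeroʳ p)) (*-identityˡ (1 + p ^ 2)))

-- Φ₆(p) = p² - p + 1, written for p = suc t.
Φ₆ : ℕ → ℕ
Φ₆ t = 1 + t * suc t

σ**-fourth : ∀ t → σ**pp (suc t) 4 ≡ (2 + t) * ((2 + t) * Φ₆ t)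
σ**-fourth t = trans (σ**-even (suc t) 2) (trans (cong (_* (1 + suc t ^ 3)) (S-two (suc t))) (cube t))
  where
  cube : ∀ t → (2 + t) * (1 + suc t * (suc t * (suc t * 1))) ≡ (2 + t) * ((2 + t) * (1 + t * suc t))
  cube = solve-∀

Φ₆≡ : ∀ t → suc t ^ 2 ∸ suc t + 1 ≡ Φ₆ t
Φ₆≡ t = begin
  suc t * (suc t * 1) ∸ suc t + 1   ≡⟨ cong (λ x → suc t * x ∸ suc t + 1) (*-identityʳ (suc t)) ⟩
  suc t + t * suc t ∸ suc t + 1     ≡⟨ cong (_+ 1) (m+n∸m≡n (suc t) (t * suc t)) ⟩
  t * suc t + 1                     ≡⟨ +-comm (t * suc t) 1 ⟩
  Φ₆ t                              ∎

Φ₆-odd : ∀ u → Odd (Φ₆ (u + u))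
Φ₆-odd u = u * suc (u + u) , oddForm u (suc (u + u))
  where
  oddForm : ∀ u p → 1 + (u + u) * p ≡ suc (u * p + u * p)
  oddForm = solve-∀

-- If p = t + 1 ≥ 3 and 3 ∣ p + 1, then 3 divides Φ₆(p) exactly once:
-- writing p = 3d + 5, Φ₆(p) = 3·(1 + 3(d + 1)(d + 2)).
Φ₆-3-part : ∀ t → 2 ≤ t → 3 ∣ 2 + t → ∃[ W ] (Φ₆ t ≡ 3 * W × ¬ 3 ∣ W × 2 ≤ W)
Φ₆-3-part t 2≤t (divides zero ())
Φ₆-3-part t (s≤s ()) (divides (suc zero) refl)
Φ₆-3-part t _ (divides (suc (suc d)) refl) =
  1 + 3 * X , expand d , 3∤ , s≤s (s≤s z≤n)
  where
  X : ℕ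
  X = (1 + d) * (2 + d)
  expand : ∀ d → 1 + suc (suc (suc (suc (d * 3)))) * suc (suc (suc (suc (suc (d * 3)))))
                 ≡ 3 * (1 + 3 * ((1 + d) * (2 + d)))
  expand = solve-∀
  3∤ : ¬ 3 ∣ 1 + 3 * X
  3∤ 3∣ = prime∤1 prime[3] (∣m+n∣m⇒∣n (subst (3 ∣_) (+-comm 1 (3 * X)) 3∣) (m∣m*n X))

module OddPrimeBase {q : ℕ} (q-prime : Prime q) (q≢2 : q ≢ 2) (a b : ℕ) where

  N : ℕ
  N = 2 ^ a * q ^ b

  q∣ : ∀ {X} → X ∣ N → OddFactor X → q ∣ X
  q∣ = oddFactor⇒q∣ a b q-prime

  q∤2 : ¬ q ∣ 2
  q∤2 q∣2 = q≢2 (prime∣prime q-prime prime[2] q∣2)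

  2∤q^b : ¬ 2 ∣ q ^ b
  2∤q^b 2∣q^b = q≢2 (sym (prime∣prime prime[2] q-prime (prime∣^ q b prime[2] 2∣q^b)))

  square+1≡ : ∀ {p M} → 1 + p ^ 2 ≡ 2 * M → M ≡ q ^ b → p ^ 2 + 1 ≡ 2 * q ^ b
  square+1≡ {p} 1+p²≡2M M≡q^b = trans (+-comm (p ^ 2) 1) (trans 1+p²≡2M (cong (2 *_) M≡q^b))

  -- e = 2k - 1 ≥ 5: q divides both S p k and 1 + p^k, hence q ∣ 2.
  oddExponent : ∀ {p} k → Odd p → 3 ≤ p → 3 ≤ k → ¬ (S p k * (1 + p ^ k) ∣ N)
  oddExponent k p-odd@(h , refl) 3≤p 3≤k σ∣N = q∤2 (common-S-1+pow (h + h) k q∣S q∣pow)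
    where
    q∣S : q ∣ S (suc (h + h)) k
    q∣S = q∣ (∣-trans (m∣m*n (1 + suc (h + h) ^ k)) σ∣N) (oddFactor-S k p-odd 3≤p 3≤k)
    q∣pow : q ∣ 1 + suc (h + h) ^ k
    q∣pow = q∣ (∣-trans (n∣m*n (S (suc (h + h)) k)) σ∣N) (oddFactor-1+pow k p-odd 3≤p (<⇒≤ 3≤k))

  -- e = 2m ≥ 6.  For odd m, q divides S p m and 1 + p^(m+1), hence q ∣ 1.
  -- For even m = 2j, σ = (1 + p)²·C·Z with C = S (p²) j, Z = cofactor;
  -- q divides C and Z = 1 + (p - 1)·p·C, hence q ∣ 1.
  evenExponent : ∀ {p} m → Odd p → 3 ≤ p → 3 ≤ m → ¬ (S p m * (1 + p ^ suc m) ∣ N)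
  evenExponent m p-odd 3≤p 3≤m σ∣N with parity m
  evenExponent .(suc (j + j)) p-odd@(h , refl) 3≤p 3≤m σ∣N | odd j =
    prime∤1 q-prime (common-S-1+pow-odd (h + h) j q∣S q∣pow)
    where
    q∣S : q ∣ S (suc (h + h)) (suc (j + j))
    q∣S = q∣ (∣-trans (m∣m*n (1 + suc (h + h) ^ suc (suc (j + j)))) σ∣N)
             (oddFactor-S (suc (j + j)) p-odd 3≤p 3≤m)
    q∣pow : q ∣ 1 + suc (h + h) ^ suc (suc (j + j))
    q∣pow = q∣ (∣-trans (n∣m*n (S (suc (h + h)) (suc (j + j)))) σ∣N)
               (oddFactor-1+pow (suc (suc (j + j))) p-odd 3≤p (s≤s (s≤s z≤n)))
  evenExponent .(j + j) (zero , refl) (s≤s ()) 3≤m σ∣N | even j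
  evenExponent .(j + j) p-odd@(suc h , refl) 3≤p 3≤m σ∣N | even j =
    prime∤1 q-prime (∣m+n∣m⇒∣n (subst (q ∣_) (+-comm 1 _) q∣Z) (∣n⇒∣m*n (t * p) q∣C))
    where
    t p C : ℕ
    t = suc h + suc h
    p = suc t
    C = S (p * p) j
    2≤j : 2 ≤ j
    2≤j = half≥2 j 3≤m
    C∣σ : C ∣ S p (j + j) * (1 + p ^ suc (j + j))
    C∣σ = ∣m⇒∣m*n (1 + p ^ suc (j + j)) (divides (1 + p) (S-evenLength p j))
    Z∣σ : cofactor t j ∣ S p (j + j) * (1 + p ^ suc (j + j))
    Z∣σ = ∣n⇒∣m*n (S p (j + j)) (divides (2 + t) (1+pow-oddExp t j))
    q∣C : q ∣ C
    q∣C = q∣ (∣-trans C∣σ σ∣N) (oddFactor-S-square j p-odd 3≤p 2≤j)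
    q∣Z : q ∣ cofactor t j
    q∣Z = q∣ (∣-trans Z∣σ σ∣N) (oddFactor-cofactor h (≤-trans (s≤s z≤n) 2≤j))

  -- e = 2: σ = 1 + p² = 2·M with M odd, so M = q^b.
  exponent2 : ∀ {p} → Odd p → σ**pp p 2 ≡ N → p ^ 2 + 1 ≡ 2 * q ^ b
  exponent2 {p} p-odd σ≡N =
    square+1≡ {p} {M} 1+p²≡2M (proj₂ (2-adic-unique 1 a {M} {q ^ b} 2-parts 2∤M 2∤q^b))
    where
    M : ℕ
    M = proj₁ (halfOf1+square p-odd)
    1+p²≡2M : 1 + p ^ 2 ≡ 2 * M
    1+p²≡2M = proj₁ (proj₂ (halfOf1+square p-odd))
    2∤M : ¬ 2 ∣ M
    2∤M = proj₂ (proj₂ (halfOf1+square p-odd))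
    2-parts : 2 ^ 1 * M ≡ N
    2-parts = trans (cong (_* M) (*-identityʳ 2)) (trans (sym 1+p²≡2M) (trans (sym (σ**-square p)) σ≡N))

  -- e = 3: σ = (1 + p)(1 + p²).  q ∣ 1 + p² but q ∤ 1 + p (else q ∣ 2), so
  -- 1 + p = 2^k, and comparing 2-parts gives a = k + 1 and (1 + p²)/2 = q^b.
  exponent3 : ∀ {p} → Odd p → 3 ≤ p → σ**pp p 3 ≡ N →
              (∃[ k ] (a ≡ k + 1 × p ≡ 2 ^ k ∸ 1)) × p ^ 2 + 1 ≡ 2 * q ^ b
  exponent3 {p} p-odd@(h , refl) 3≤p σ≡N =
    (k , trans (sym (proj₁ compare)) (+-comm 1 k) , cong (_∸ 1) 1+p≡2^k) ,
    square+1≡ {p} {M} 1+p²≡2M (proj₂ compare)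
    where
    σ-form : (1 + p) * (1 + p ^ 2) ≡ N
    σ-form = trans (cong (_* (1 + p ^ 2)) (sym (S-two p))) (trans (sym (σ**-odd p 1)) σ≡N)
    σ∣N : (1 + p) * (1 + p ^ 2) ∣ N
    σ∣N = ∣-reflexive σ-form
    q∣1+p² : q ∣ 1 + p ^ 2
    q∣1+p² = q∣ (∣-trans (n∣m*n (1 + p)) σ∣N) (oddFactor-1+square p-odd 3≤p)
    q∤1+p : ¬ q ∣ 1 + p
    q∤1+p q∣1+p = q∤2 (common-S-1+pow (h + h) 2 (subst (q ∣_) (sym (S-two p)) q∣1+p) q∣1+p²)
    two-power : ∃[ k ] 1 + p ≡ 2 ^ k
    two-power = powerOfTwo a b (1 + p) q-prime (∣-trans (m∣m*n (1 + p ^ 2)) σ∣N) q∤1+p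
    k : ℕ
    k = proj₁ two-power
    1+p≡2^k : 1 + p ≡ 2 ^ k
    1+p≡2^k = proj₂ two-power
    M : ℕ
    M = proj₁ (halfOf1+square p-odd)
    1+p²≡2M : 1 + p ^ 2 ≡ 2 * M
    1+p²≡2M = proj₁ (proj₂ (halfOf1+square p-odd))
    2∤M : ¬ 2 ∣ M
    2∤M = proj₂ (proj₂ (halfOf1+square p-odd))
    regroup : ∀ x m → 2 * x * m ≡ x * (2 * m)
    regroup = solve-∀
    2-parts : 2 ^ suc k * M ≡ N
    2-parts = begin
      2 * 2 ^ k * M         ≡⟨ regroup (2 ^ k) M ⟩
      2 ^ k * (2 * M)       ≡⟨ cong₂ _*_ (sym 1+p≡2^k) (sym 1+p²≡2M) ⟩
      (1 + p) * (1 + p ^ 2) ≡⟨ σ-form ⟩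
      N                     ∎
    compare : suc k ≡ a × M ≡ q ^ b
    compare = 2-adic-unique (suc k) a {M} {q ^ b} 2-parts 2∤M 2∤q^b

  -- e = 4 and q ∣ 1 + p: then q ∣ 3 since Φ₆(p) = (1 + p)(p - 2) + 3, so
  -- q = 3 and Φ₆(p) = 3·W with W odd, W > 1 and 3 ∤ W; but q ∣ W.
  Φ₆-q∤1+p : ∀ h → Φ₆ (suc h + suc h) ∣ N → ¬ q ∣ 2 + (suc h + suc h)
  Φ₆-q∤1+p h Φ∣N q∣1+p = 3∤W (subst (_∣ W) q≡3 (q∣ W∣N (W , ∣-refl , 2∤W , 2≤W)))
    where
    t : ℕ
    t = suc h + suc h
    split : ∀ h → 1 + (suc h + suc h) * suc (suc h + suc h) ≡ (2 + (suc h + suc h)) * (h + suc h) + 3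
    split = solve-∀
    q∣Φ : q ∣ Φ₆ t
    q∣Φ = q∣ Φ∣N (oddFactor-self (Φ₆-odd (suc h)) (s≤s (s≤s z≤n)))
    q≡3 : q ≡ 3
    q≡3 = prime∣prime q-prime prime[3]
            (∣m+n∣m⇒∣n (subst (q ∣_) (split h) q∣Φ) (∣m⇒∣m*n (h + suc h) q∣1+p))
    3-part : ∃[ W ] (Φ₆ t ≡ 3 * W × ¬ 3 ∣ W × 2 ≤ W)
    3-part = Φ₆-3-part t (s≤s (≤-trans (s≤s z≤n) (m≤n+m (suc h) h))) (subst (_∣ 2 + t) q≡3 q∣1+p)
    W : ℕ
    W = proj₁ 3-part
    Φ≡3W : Φ₆ t ≡ 3 * W
    Φ≡3W = proj₁ (proj₂ 3-part)
    3∤W : ¬ 3 ∣ W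
    3∤W = proj₁ (proj₂ (proj₂ 3-part))
    2≤W : 2 ≤ W
    2≤W = proj₂ (proj₂ (proj₂ 3-part))
    2∤W : ¬ 2 ∣ W
    2∤W 2∣W = odd⇒2∤ (Φ₆-odd (suc h)) (subst (2 ∣_) (sym Φ≡3W) (∣n⇒∣m*n 3 2∣W))
    W∣N : W ∣ N
    W∣N = ∣-trans (divides 3 Φ≡3W) Φ∣N

  -- e = 4: σ = (1 + p)²·Φ₆(p) with Φ₆(p) odd; 1 + p is prime to q, hence
  -- 1 + p = 2^k, and comparing 2-parts gives a = 2k and Φ₆(p) = q^b.
  exponent4 : ∀ {p} → Odd p → 3 ≤ p → σ**pp p 4 ≡ N →
              (∃[ k ] (a ≡ 2 * k × p ≡ 2 ^ k ∸ 1)) × p ^ 2 ∸ p + 1 ≡ q ^ b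
  exponent4 (zero  , refl) (s≤s ()) σ≡N
  exponent4 (suc h , refl) 3≤p σ≡N =
    (k , a≡2k , cong (_∸ 1) 1+p≡2^k) , trans (Φ₆≡ t) (proj₂ compare)
    where
    t : ℕ
    t = suc h + suc h
    σ-form : (2 + t) * ((2 + t) * Φ₆ t) ≡ N
    σ-form = trans (sym (σ**-fourth t)) σ≡N
    Φ∣N : Φ₆ t ∣ N
    Φ∣N = ∣-trans (n∣m*n (2 + t)) (∣-trans (n∣m*n (2 + t)) (∣-reflexive σ-form))
    two-power : ∃[ k ] 2 + t ≡ 2 ^ k
    two-power = powerOfTwo a b (2 + t) q-prime (∣-trans (m∣m*n ((2 + t) * Φ₆ t)) (∣-reflexive σ-form))
                           (Φ₆-q∤1+p h Φ∣N)
    k : ℕ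
    k = proj₁ two-power
    1+p≡2^k : 2 + t ≡ 2 ^ k
    1+p≡2^k = proj₂ two-power
    2-parts : 2 ^ (k + k) * Φ₆ t ≡ N
    2-parts = begin
      2 ^ (k + k) * Φ₆ t          ≡⟨ cong (_* Φ₆ t) (^-distribˡ-+-* 2 k k) ⟩
      2 ^ k * 2 ^ k * Φ₆ t        ≡⟨ *-assoc (2 ^ k) (2 ^ k) (Φ₆ t) ⟩
      2 ^ k * (2 ^ k * Φ₆ t)      ≡⟨ cong (λ x → x * (x * Φ₆ t)) (sym 1+p≡2^k) ⟩
      (2 + t) * ((2 + t) * Φ₆ t)  ≡⟨ σ-form ⟩
      N                           ∎
    compare : k + k ≡ a × Φ₆ t ≡ q ^ b
    compare = 2-adic-unique (k + k) a {Φ₆ t} {q ^ b} 2-parts (odd⇒2∤ (Φ₆-odd (suc h))) 2∤q^b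
    a≡2k : a ≡ 2 * k
    a≡2k = trans (sym (proj₁ compare)) (cong (k +_) (sym (+-identityʳ k)))

  classify : ∀ {p} e → Prime p → p ≢ 2 → e ≥ 1 → σ**pp p e ≡ N →
        (e ≡ 1)
        ⊎ (e ≡ 2 × p ^ 2 + 1 ≡ 2 * q ^ b)
        ⊎ (e ≡ 3 × (∃[ k ] (a ≡ k + 1 × p ≡ 2 ^ k ∸ 1)) × Prime p × p ^ 2 + 1 ≡ 2 * q ^ b)
        ⊎ (e ≡ 4 × (∃[ k ] (a ≡ 2 * k × p ≡ 2 ^ k ∸ 1)) × Prime p × p ^ 2 ∸ p + 1 ≡ q ^ b)
  classify {p} e pp p≢2 e≥1 σ≡N with oddPrime pp p≢2 | parity e
  ... | p-odd , 3≤p | odd zero = inj₁ refl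
  ... | p-odd , 3≤p | odd (suc zero) =
    let (mersenne , square) = exponent3 p-odd 3≤p σ≡N
    in  inj₂ (inj₂ (inj₁ (refl , mersenne , pp , square)))
  ... | p-odd , 3≤p | odd k@(suc (suc _)) =
    ⊥-elim (oddExponent (suc k) p-odd 3≤p (s≤s (s≤s (s≤s z≤n)))
                        (∣-reflexive (trans (sym (σ**-odd p k)) σ≡N)))
  ... | p-odd , 3≤p | even zero = ⊥-elim (n≮0 e≥1)
  ... | p-odd , 3≤p | even (suc zero) = inj₂ (inj₁ (refl , exponent2 p-odd σ≡N))
  ... | p-odd , 3≤p | even (suc (suc zero)) =
    let (mersenne , Φ₆≡q^b) = exponent4 p-odd 3≤p σ≡N
    in  inj₂ (inj₂ (inj₂ (refl , mersenne , pp , Φ₆≡q^b)))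
  ... | p-odd , 3≤p | even m@(suc (suc (suc _))) =
    ⊥-elim (evenExponent m p-odd 3≤p (s≤s (s≤s (s≤s z≤n)))
                         (∣-reflexive (trans (sym (σ**-even p m)) σ≡N)))

2∤S₂ : ∀ k → ¬ 2 ∣ S 2 (suc k)
2∤S₂ k = odd⇒2∤ (S 2 k , cong (λ x → suc (S 2 k + x)) (+-identityʳ (S 2 k)))

-- For k ≥ 2, S 2 k·(1 + 2^k) is not a prime power: a prime dividing both
-- factors divides 2, while S 2 k is odd.
notPrimePower : ∀ {r m} k → Prime r → 2 ≤ k → ¬ (S 2 k * (1 + 2 ^ k) ∣ r ^ m)
notPrimePower {r} {m} (suc k) pr 2≤k σ∣r^m = 2∤S₂ k (subst (_∣ S 2 (suc k)) r≡2 r∣S)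
  where
  r∣S : r ∣ S 2 (suc k)
  r∣S = primePowerDivisor m pr (∣-trans (m∣m*n (1 + 2 ^ suc k)) σ∣r^m) (≤-trans 2≤k (n≤S 1 (suc k)))
  r∣pow : r ∣ 1 + 2 ^ suc k
  r∣pow = primePowerDivisor m pr (∣-trans (n∣m*n (S 2 (suc k))) σ∣r^m) (s≤s (m^n>0 2 (suc k)))
  r≡2 : r ≡ 2
  r≡2 = prime∣prime pr prime[2] (common-S-1+pow 1 (suc k) r∣S r∣pow)

-- e = 2n ≥ 6: for odd n a prime dividing S 2 n and 1 + 2^(n+1) divides 1;
-- for even n = 2j the factor S 2 j·(1 + 2^j) of S 2 n is not a prime power.
evenExponent₂ : ∀ {r m} n → Prime r → 3 ≤ n → ¬ (S 2 n * (1 + 2 ^ suc n) ∣ r ^ m)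
evenExponent₂ n pr 3≤n σ∣r^m with parity n
evenExponent₂ {r} {m} .(suc (j + j)) pr 3≤n σ∣r^m | odd j = prime∤1 pr (common-S-1+pow-odd 1 j r∣S r∣pow)
  where
  r∣S : r ∣ S 2 (suc (j + j))
  r∣S = primePowerDivisor m pr (∣-trans (m∣m*n (1 + 2 ^ suc (suc (j + j)))) σ∣r^m)
                          (≤-trans (<⇒≤ 3≤n) (n≤S 1 (suc (j + j))))
  r∣pow : r ∣ 1 + 2 ^ suc (suc (j + j))
  r∣pow = primePowerDivisor m pr (∣-trans (n∣m*n (S 2 (suc (j + j)))) σ∣r^m)
                            (s≤s (m^n>0 2 (suc (suc (j + j)))))
evenExponent₂ {m = m} .(j + j) pr 3≤n σ∣r^m | even j =
  notPrimePower {m = m} j pr (half≥2 j 3≤n)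
    (∣-trans (∣-reflexive (sym (S-double 2 j))) (∣-trans (m∣m*n (1 + 2 ^ suc (j + j))) σ∣r^m))

σ**-two-power : (e : ℕ) → e ≥ 1 → (∃[ r ] ∃[ m ] (Prime r × m ≥ 1 × σ**pp 2 e ≡ r ^ m)) → e ≤ 4
σ**-two-power e _ (r , m , pr , _ , σ≡r^m) with parity e
... | odd zero                = s≤s z≤n
... | odd (suc zero)          = s≤s (s≤s (s≤s z≤n))
... | odd k@(suc (suc _))     =
  ⊥-elim (notPrimePower {m = m} (suc k) pr (s≤s (s≤s z≤n)) (∣-reflexive (trans (sym (σ**-odd 2 k)) σ≡r^m)))
... | even zero               = z≤n
... | even (suc zero)         = s≤s (s≤s z≤n)
... | even (suc (suc zero))   = ≤-refl
... | even n@(suc (suc (suc _))) =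
  ⊥-elim (evenExponent₂ {m = m} n pr (s≤s (s≤s (s≤s z≤n)))
                        (∣-reflexive (trans (sym (σ**-even 2 n)) σ≡r^m)))

mainTheorem4 : ((p q e a b : ℕ) → Prime p → Prime q → p ≢ 2 → q ≢ 2 → e ≥ 1 →
    σ**pp p e ≡ 2 ^ a * q ^ b →
    (e ≡ 1)
    ⊎ (e ≡ 2 × p ^ 2 + 1 ≡ 2 * q ^ b)
    ⊎ (e ≡ 3 × (∃[ k ] (a ≡ k + 1 × p ≡ 2 ^ k ∸ 1)) × Prime p × p ^ 2 + 1 ≡ 2 * q ^ b)
    ⊎ (e ≡ 4 × (∃[ k ] (a ≡ 2 * k × p ≡ 2 ^ k ∸ 1)) × Prime p × p ^ 2 ∸ p + 1 ≡ q ^ b))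
    ×
    ((e : ℕ) → e ≥ 1 → (∃[ r ] ∃[ m ] (Prime r × m ≥ 1 × σ**pp 2 e ≡ r ^ m)) → e ≤ 4)
mainTheorem4 =
  (λ p q e a b pp pq p≢2 q≢2 → OddPrimeBase.classify pq q≢2 a b e pp p≢2) ,
  σ**-two-power
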